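{- For $n\ge 4$, the number $SM(f_n)$ of singleton MCSs in the Fibonacci word $f_n$ (i.e., the number of positions $i$ such that the occurrence $f_n[i..i]$ is a maximal closed substring of $f_n$) is $$SM(f_n)=\begin{cases}F_{n-2}+F_{n-4}+2, & \text{if } n \text{ is odd},\\ F_{n-2}+F_{n-4}, & \text{if } n \text{ is even}.\end{cases}$$
   Context: Fibonacci words are defined by $f_0=0$, $f_1=1$, $f_n=f_{n-1}f_{n-2}$ for $n\ge2$, and $F_n=|f_n|$ (so $F_0=F_1=1$, $F_n=F_{n-1}+F_{n-2}$). Strings are indexed from 1. A border of a string $x$ is a nonempty string that is both a proper prefix and a proper suffix of $x$. A string $x$ is closed if $|x|=1$, or $|x|\ge2$ and $x$ has a border occurring in $x$ only as a prefix and as a suffix and nowhere else. In a string $w[1..N]$, an occurrence $w[i..j]$ is maximal right-closed if it is closed and either $j=N$ or $w[i..j+1]$ is not closed; maximal left-closed if it is closed and either $i=1$ or $w[i-1..j]$ is not closed; and a maximal closed substring (MCS) if it is both. An MCS of length one is called singleton. -}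

module Defs where

open import Data.Bool using (Bool; true; false)
open import Data.Nat using (ℕ; zero; suc; _+_; _∸_; _≤_; _<_)
open import Data.List using (List; []; _∷_; _++_; length; take; drop)
open import Data.List.Membership.Propositional using (_∈_)
open import Data.List.Relation.Unary.Unique.Propositional using (Unique)
open import Data.Product using (Σ; _×_; ∃)
open import Data.Sum using (_⊎_)
open import Relation.Binary.PropositionalEquality using (_≡_)
open import Relation.Nullary using (¬_)
open import Function.Bundles using (_⇔_)

-- Letters: false = 0, true = 1.
Word : Set
Word = List Bool

fibWord : ℕ → Word
fibWord zero = false ∷ []
fibWord (suc zero) = true ∷ []
fibWord (suc (suc n)) = fibWord (suc n) ++ fibWord n

F : ℕ → ℕ
F zero = 1
F (suc zero) = 1
F (suc (suc n)) = F (suc n) + F n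

-- b occurs in x starting at 0-based offset k
OccursAt : Word → Word → ℕ → Set
OccursAt b x k = (k + length b ≤ length x) × (take (length b) (drop k x) ≡ b)

IsBorder : Word → Word → Set
IsBorder b x = (0 < length b) × (length b < length x)
             × OccursAt b x 0 × OccursAt b x (length x ∸ length b)

Closed : Word → Set
Closed x = (length x ≡ 1)
         ⊎ ((2 ≤ length x) × Σ Word (λ b → IsBorder b x ×
              (∀ k → OccursAt b x k → (k ≡ 0) ⊎ (k ≡ length x ∸ length b))))

-- the occurrence w[i..j] (1-indexed, inclusive)
sub : Word → ℕ → ℕ → Word
sub w i j = take (suc j ∸ i) (drop (i ∸ 1) w)

ValidOcc : Word → ℕ → ℕ → Set
ValidOcc w i j = (1 ≤ i) × (i ≤ j) × (j ≤ length w)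

MaxRightClosed : Word → ℕ → ℕ → Set
MaxRightClosed w i j = ValidOcc w i j × Closed (sub w i j)
  × ((j ≡ length w) ⊎ ¬ Closed (sub w i (suc j)))

MaxLeftClosed : Word → ℕ → ℕ → Set
MaxLeftClosed w i j = ValidOcc w i j × Closed (sub w i j)
  × ((i ≡ 1) ⊎ ¬ Closed (sub w (i ∸ 1) j))

MCS : Word → ℕ → ℕ → Set
MCS w i j = MaxRightClosed w i j × MaxLeftClosed w i j

SingletonMCS : Word → ℕ → Set
SingletonMCS w i = MCS w i i

HasCount : (ℕ → Set) → ℕ → Set
HasCount P c = Σ (List ℕ) (λ L → Unique L × (∀ i → (i ∈ L) ⇔ P i) × (length L ≡ c))

-- A one-letter occurrence is always closed, and a two-letter word is closed exactly
-- when its two letters coincide. Hence position i is a singleton MCS of w iff w[i]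
-- differs from each neighbour it has, i.e. iff the letter at i is isolated.
-- Counting isolated letters with a prescribed letter (or none) outside each end is
-- additive over concatenation. In f(n+2) = f(n+1) f(n) the junction joins the last
-- letter of f(n+1), which is 1 iff n+1 is odd, to the first letter 1 of f(n); the end
-- letters of every f(n) with n ≥ 4 are isolated, so each side loses exactly one
-- isolated letter when n+1 is odd and none otherwise. This yields
-- SM(f(n+2)) = SM(f(n+1)) + SM(f(n)) - 2[n+1 odd], solved by the closed form.
module Submission where

open import Defs
open import Data.Nat using (ℕ; zero; suc; _+_; _∸_; _≤_; _%_; z≤n; s≤s)
open import Data.Nat.Properties using (+-assoc; ≤-trans; m≤n+m; +-cancelʳ-≡; +-identityʳ; ≤-refl; suc-injective)
open import Data.Nat.Tactic.RingSolver using (solve-∀)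
open import Data.Bool using (Bool; true; false; T; _∧_; _xor_; if_then_else_)
open import Data.Bool.Properties using (T-∧; xor-comm)
open import Data.Maybe using (Maybe; just; nothing)
open import Data.List using (List; []; _∷_; _++_; length; map)
open import Data.List.Properties using (length-map)
open import Data.List.Membership.Propositional using (_∈_; _∉_)
open import Data.List.Membership.Propositional.Properties using (∈-map⁺; ∈-map⁻)
open import Data.List.Relation.Unary.Any using (here; there)
open import Data.List.Relation.Unary.All using (tabulate)
open import Data.List.Relation.Unary.AllPairs using ([]; _∷_)
open import Data.List.Relation.Unary.Unique.Propositional using (Unique)
import Data.List.Relation.Unary.Unique.Propositional.Properties as Unique
open import Data.Product using (_×_; _,_; proj₁; proj₂)
open import Data.Sum using (_⊎_; inj₁; inj₂)
import Data.Sum as Sum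
open import Data.Empty using (⊥)
open import Relation.Nullary using (¬_; contradiction)
open import Relation.Binary.PropositionalEquality using (_≡_; refl; sym; trans; cong; cong₂; subst; module ≡-Reasoning)
open import Function.Bundles using (_⇔_; mk⇔; Equivalence)
import Function.Properties.Equivalence as ⇔

closed-pair : ∀ a → Closed (a ∷ a ∷ [])
closed-pair a = inj₂ (s≤s (s≤s z≤n) , a ∷ [] , border , onlyAtEnds)
  where
  border : IsBorder (a ∷ []) (a ∷ a ∷ [])
  border = s≤s z≤n , s≤s (s≤s z≤n) , (s≤s z≤n , refl) , (s≤s (s≤s z≤n) , refl)
  onlyAtEnds : ∀ k → OccursAt (a ∷ []) (a ∷ a ∷ []) k → (k ≡ 0) ⊎ (k ≡ 1)
  onlyAtEnds zero _ = inj₁ refl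
  onlyAtEnds (suc zero) _ = inj₂ refl
  onlyAtEnds (suc (suc k)) (s≤s (s≤s k+1≤0) , _) with ≤-trans (m≤n+m 1 k) k+1≤0
  ... | ()

closed-pair⇒≡ : ∀ {a b} → Closed (a ∷ b ∷ []) → a ≡ b
closed-pair⇒≡ (inj₁ ())
closed-pair⇒≡ (inj₂ (_ , [] , (() , _) , _))
closed-pair⇒≡ (inj₂ (_ , _ ∷ [] , (_ , _ , (_ , refl) , (_ , refl)) , _)) = refl
closed-pair⇒≡ (inj₂ (_ , _ ∷ _ ∷ _ , (_ , s≤s (s≤s ()) , _) , _))

¬closed-pair⇔xor : ∀ a b → (¬ Closed (a ∷ b ∷ [])) ⇔ T (a xor b)
¬closed-pair⇔xor false false = mk⇔ (λ notClosed → notClosed (closed-pair false)) λ ()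
¬closed-pair⇔xor true true = mk⇔ (λ notClosed → notClosed (closed-pair true)) λ ()
¬closed-pair⇔xor false true = mk⇔ _ λ _ c → contradiction (closed-pair⇒≡ c) λ ()
¬closed-pair⇔xor true false = mk⇔ _ λ _ c → contradiction (closed-pair⇒≡ c) λ ()

¬closed-pair⇔xorʳ : ∀ a b → (¬ Closed (a ∷ b ∷ [])) ⇔ T (b xor a)
¬closed-pair⇔xorʳ a b = subst (λ t → (¬ Closed (a ∷ b ∷ [])) ⇔ T t) (xor-comm a b) (¬closed-pair⇔xor a b)

-- The letter just outside one end of a word; nothing at a boundary of the whole word.
Context : Set
Context = Maybe Bool

differsFrom : Context → Bool → Bool
differsFrom nothing _ = true
differsFrom (just c) x = c xor x

isolatedᵇ : Context → Bool → Context → Bool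
isolatedᵇ l x r = differsFrom l x ∧ differsFrom r x

headOr : Word → Context → Context
headOr [] r = r
headOr (x ∷ _) r = just x

lastOr : Context → Word → Context
lastOr l [] = l
lastOr l (x ∷ xs) = lastOr (just x) xs

positions∷ : Bool → List ℕ → List ℕ
positions∷ true ps = 1 ∷ map suc ps
positions∷ false ps = map suc ps

-- 1-based positions of the isolated letters of w, placed between the contexts l and r.
isolatedPositions : Context → Word → Context → List ℕ
isolatedPositions l [] r = []
isolatedPositions l (x ∷ xs) r = positions∷ (isolatedᵇ l x (headOr xs r)) (isolatedPositions (just x) xs r)

isolatedCount : Context → Word → Context → ℕ
isolatedCount l w r = length (isolatedPositions l w r)

0∉map-suc : ∀ ps → 0 ∉ map suc ps
0∉map-suc ps 0∈ with ∈-map⁻ suc 0∈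
... | _ , _ , ()

0∉positions∷ : ∀ b ps → 0 ∉ positions∷ b ps
0∉positions∷ true ps (there 0∈) = 0∉map-suc ps 0∈
0∉positions∷ false ps 0∈ = 0∉map-suc ps 0∈

1∉map-suc : ∀ {ps} → 0 ∉ ps → 1 ∉ map suc ps
1∉map-suc 0∉ps 1∈ with ∈-map⁻ suc 1∈
... | .0 , 0∈ps , refl = 0∉ps 0∈ps

1∈positions∷⇔ : ∀ b {ps} → 0 ∉ ps → 1 ∈ positions∷ b ps ⇔ T b
1∈positions∷⇔ true 0∉ps = mk⇔ _ λ _ → here refl
1∈positions∷⇔ false 0∉ps = mk⇔ (1∉map-suc 0∉ps) λ ()

2+∈positions∷⇔ : ∀ b ps k → suc (suc k) ∈ positions∷ b ps ⇔ suc k ∈ ps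
2+∈positions∷⇔ b ps k = mk⇔ (from b) (to b)
  where
  from-map : suc (suc k) ∈ map suc ps → suc k ∈ ps
  from-map ∈map with ∈-map⁻ suc ∈map
  ... | .(suc k) , ∈ps , refl = ∈ps
  from : ∀ b → suc (suc k) ∈ positions∷ b ps → suc k ∈ ps
  from true (there ∈map) = from-map ∈map
  from false ∈map = from-map ∈map
  to : ∀ b → suc k ∈ ps → suc (suc k) ∈ positions∷ b ps
  to true ∈ps = there (∈-map⁺ suc ∈ps)
  to false ∈ps = ∈-map⁺ suc ∈ps

length-positions∷ : ∀ b ps → length (positions∷ b ps) ≡ length (positions∷ b []) + length ps
length-positions∷ true ps = cong suc (length-map suc ps)
length-positions∷ false ps = length-map suc ps

unique-positions∷ : ∀ b {ps} → 0 ∉ ps → Unique ps → Unique (positions∷ b ps)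
unique-positions∷ true 0∉ps u = tabulate (λ { ∈map refl → 1∉map-suc 0∉ps ∈map }) ∷ Unique.map⁺ suc-injective u
unique-positions∷ false 0∉ps u = Unique.map⁺ suc-injective u

0∉isolatedPositions : ∀ l w r → 0 ∉ isolatedPositions l w r
0∉isolatedPositions l [] r ()
0∉isolatedPositions l (x ∷ xs) r = 0∉positions∷ (isolatedᵇ l x (headOr xs r)) (isolatedPositions (just x) xs r)

unique-isolatedPositions : ∀ l w r → Unique (isolatedPositions l w r)
unique-isolatedPositions l [] r = []
unique-isolatedPositions l (x ∷ xs) r =
  unique-positions∷ (isolatedᵇ l x (headOr xs r)) (0∉isolatedPositions (just x) xs r) (unique-isolatedPositions (just x) xs r)

-- With a context letter c, position i of w is read as position i + 1 of c ∷ w.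
SingletonMCSIn : Context → Word → ℕ → Set
SingletonMCSIn nothing w i = SingletonMCS w i
SingletonMCSIn (just c) w zero = ⊥
SingletonMCSIn (just c) w (suc i) = SingletonMCS (c ∷ w) (suc (suc i))

¬singletonMCSIn-0 : ∀ l w → ¬ SingletonMCSIn l w zero
¬singletonMCSIn-0 nothing w (((() , _) , _) , _)
¬singletonMCSIn-0 (just c) w ()

-- For i ≥ 2, sub (z ∷ w) (1 + i) (1 + j) reduces to sub w i j; only ValidOcc and the
-- end-of-word alternatives need reindexing.
singletonMCS-∷⇔ : ∀ z w i → SingletonMCS (z ∷ w) (suc (suc (suc i))) ⇔ SingletonMCS w (suc (suc i))
singletonMCS-∷⇔ z w i = mk⇔ to from
  where
  to : SingletonMCS (z ∷ w) (suc (suc (suc i))) → SingletonMCS w (suc (suc i))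
  to ((v , c , r) , (v′ , c′ , l)) = (valid v , c , Sum.map₁ suc-injective r) , (valid v′ , c′ , Sum.map₁ (λ ()) l)
    where
    valid : ValidOcc (z ∷ w) (suc (suc (suc i))) (suc (suc (suc i))) → ValidOcc w (suc (suc i)) (suc (suc i))
    valid (_ , _ , s≤s i≤) = s≤s z≤n , ≤-refl , i≤
  from : SingletonMCS w (suc (suc i)) → SingletonMCS (z ∷ w) (suc (suc (suc i)))
  from ((v , c , r) , (v′ , c′ , l)) = (valid v , c , Sum.map₁ (cong suc) r) , (valid v′ , c′ , Sum.map₁ (λ ()) l)
    where
    valid : ValidOcc w (suc (suc i)) (suc (suc i)) → ValidOcc (z ∷ w) (suc (suc (suc i))) (suc (suc (suc i)))
    valid (_ , _ , i≤) = s≤s z≤n , ≤-refl , s≤s i≤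

singletonMCSIn-2+⇔ : ∀ l x xs k → SingletonMCSIn l (x ∷ xs) (suc (suc k)) ⇔ SingletonMCSIn (just x) xs (suc k)
singletonMCSIn-2+⇔ nothing x xs k = ⇔.refl
singletonMCSIn-2+⇔ (just z) x xs k = singletonMCS-∷⇔ z (x ∷ xs) k

singletonMCSIn-1⇔ : ∀ l x xs → SingletonMCSIn l (x ∷ xs) 1 ⇔ T (isolatedᵇ l x (headOr xs nothing))
singletonMCSIn-1⇔ nothing x [] = mk⇔ _ λ _ → (valid , inj₁ refl , inj₁ refl) , (valid , inj₁ refl , inj₁ refl)
  where
  valid : ValidOcc (x ∷ []) 1 1
  valid = ≤-refl , ≤-refl , ≤-refl
singletonMCSIn-1⇔ nothing x (y ∷ ys) = mk⇔ to from
  where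
  valid : ValidOcc (x ∷ y ∷ ys) 1 1
  valid = ≤-refl , ≤-refl , s≤s z≤n
  to : SingletonMCS (x ∷ y ∷ ys) 1 → T (y xor x)
  to ((_ , _ , inj₂ notClosed) , _) = Equivalence.to (¬closed-pair⇔xorʳ x y) notClosed
  from : T (y xor x) → SingletonMCS (x ∷ y ∷ ys) 1
  from t = (valid , inj₁ refl , inj₂ (Equivalence.from (¬closed-pair⇔xorʳ x y) t)) , (valid , inj₁ refl , inj₁ refl)
singletonMCSIn-1⇔ (just z) x [] = mk⇔ to from
  where
  valid : ValidOcc (z ∷ x ∷ []) 2 2
  valid = s≤s z≤n , ≤-refl , ≤-refl
  to : SingletonMCS (z ∷ x ∷ []) 2 → T ((z xor x) ∧ true)
  to (_ , (_ , _ , inj₂ notClosed)) = Equivalence.from T-∧ (Equivalence.to (¬closed-pair⇔xor z x) notClosed , _)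
  from : T ((z xor x) ∧ true) → SingletonMCS (z ∷ x ∷ []) 2
  from t = (valid , inj₁ refl , inj₁ refl) ,
           (valid , inj₁ refl , inj₂ (Equivalence.from (¬closed-pair⇔xor z x) (proj₁ (Equivalence.to T-∧ t))))
singletonMCSIn-1⇔ (just z) x (y ∷ ys) = mk⇔ to from
  where
  valid : ValidOcc (z ∷ x ∷ y ∷ ys) 2 2
  valid = s≤s z≤n , ≤-refl , s≤s (s≤s z≤n)
  to : SingletonMCS (z ∷ x ∷ y ∷ ys) 2 → T ((z xor x) ∧ (y xor x))
  to ((_ , _ , inj₂ notClosedʳ) , (_ , _ , inj₂ notClosedˡ)) =
    Equivalence.from T-∧ (Equivalence.to (¬closed-pair⇔xor z x) notClosedˡ , Equivalence.to (¬closed-pair⇔xorʳ x y) notClosedʳ)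
  from : T ((z xor x) ∧ (y xor x)) → SingletonMCS (z ∷ x ∷ y ∷ ys) 2
  from t = (valid , inj₁ refl , inj₂ (Equivalence.from (¬closed-pair⇔xorʳ x y) (proj₂ (Equivalence.to T-∧ t)))) ,
           (valid , inj₁ refl , inj₂ (Equivalence.from (¬closed-pair⇔xor z x) (proj₁ (Equivalence.to T-∧ t))))

∈isolatedPositions⇔ : ∀ l w i → i ∈ isolatedPositions l w nothing ⇔ SingletonMCSIn l w i
∈isolatedPositions⇔ l w zero =
  mk⇔ (λ 0∈ → contradiction 0∈ (0∉isolatedPositions l w nothing)) (λ s → contradiction s (¬singletonMCSIn-0 l w))
∈isolatedPositions⇔ l [] (suc i) = mk⇔ (λ ()) (outOfRange l)
  where
  outOfRange : ∀ l → SingletonMCSIn l [] (suc i) → suc i ∈ []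
  outOfRange nothing (((_ , _ , ()) , _) , _)
  outOfRange (just z) (((_ , _ , s≤s ()) , _) , _)
∈isolatedPositions⇔ l (x ∷ xs) (suc zero) =
  ⇔.trans (1∈positions∷⇔ (isolatedᵇ l x (headOr xs nothing)) (0∉isolatedPositions (just x) xs nothing))
          (⇔.sym (singletonMCSIn-1⇔ l x xs))
∈isolatedPositions⇔ l (x ∷ xs) (suc (suc k)) =
  ⇔.trans (2+∈positions∷⇔ (isolatedᵇ l x (headOr xs nothing)) (isolatedPositions (just x) xs nothing) k)
  (⇔.trans (∈isolatedPositions⇔ (just x) xs (suc k))
           (⇔.sym (singletonMCSIn-2+⇔ l x xs k)))

singletonMCS-hasCount : ∀ w → HasCount (SingletonMCS w) (isolatedCount nothing w nothing)
singletonMCS-hasCount w =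
  isolatedPositions nothing w nothing , unique-isolatedPositions nothing w nothing , ∈isolatedPositions⇔ nothing w , refl

headOr-++ : ∀ a b r → headOr (a ++ b) r ≡ headOr a (headOr b r)
headOr-++ [] b r = refl
headOr-++ (x ∷ a) b r = refl

lastOr-++ : ∀ l a b → lastOr l (a ++ b) ≡ lastOr (lastOr l a) b
lastOr-++ l [] b = refl
lastOr-++ l (x ∷ a) b = lastOr-++ (just x) a b

isolatedCount-++ : ∀ l a b r → isolatedCount l (a ++ b) r ≡ isolatedCount l a (headOr b r) + isolatedCount (lastOr l a) b r
isolatedCount-++ l [] b r = refl
isolatedCount-++ l (x ∷ a) b r = begin
  length (positions∷ (isolatedᵇ l x (headOr (a ++ b) r)) (isolatedPositions (just x) (a ++ b) r))
    ≡⟨ cong (λ c → length (positions∷ (isolatedᵇ l x c) (isolatedPositions (just x) (a ++ b) r))) (headOr-++ a b r) ⟩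
  length (positions∷ β (isolatedPositions (just x) (a ++ b) r))
    ≡⟨ length-positions∷ β _ ⟩
  length (positions∷ β []) + isolatedCount (just x) (a ++ b) r
    ≡⟨ cong (length (positions∷ β []) +_) (isolatedCount-++ (just x) a b r) ⟩
  length (positions∷ β []) + (isolatedCount (just x) a (headOr b r) + isolatedCount (lastOr (just x) a) b r)
    ≡⟨ sym (+-assoc (length (positions∷ β [])) _ _) ⟩
  (length (positions∷ β []) + isolatedCount (just x) a (headOr b r)) + isolatedCount (lastOr (just x) a) b r
    ≡⟨ cong (_+ isolatedCount (lastOr (just x) a) b r) (sym (length-positions∷ β _)) ⟩
  isolatedCount l (x ∷ a) (headOr b r) + isolatedCount (lastOr l (x ∷ a)) b r ∎
  where
  open ≡-Reasoning
  β : Bool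
  β = isolatedᵇ l x (headOr a (headOr b r))

isOdd : ℕ → Bool
isOdd zero = false
isOdd (suc zero) = true
isOdd (suc (suc n)) = isOdd n

headOr-fibWord-suc : ∀ n r → headOr (fibWord (suc n)) r ≡ just true
headOr-fibWord-suc zero r = refl
headOr-fibWord-suc (suc n) r = trans (headOr-++ (fibWord (suc n)) (fibWord n) r) (headOr-fibWord-suc n _)

lastOr-fibWord : ∀ l n → lastOr l (fibWord n) ≡ just (isOdd n)
lastOr-fibWord l zero = refl
lastOr-fibWord l (suc zero) = refl
lastOr-fibWord l (suc (suc n)) = trans (lastOr-++ l (fibWord (suc n)) (fibWord n)) (lastOr-fibWord _ n)

isolatedCount-fibWord-3+ : ∀ l n r →
  isolatedCount l (fibWord (3 + n)) r ≡ isolatedCount l (fibWord (2 + n)) (just true) + isolatedCount (just (isOdd n)) (fibWord (1 + n)) r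
isolatedCount-fibWord-3+ l n r = trans (isolatedCount-++ l (fibWord (2 + n)) (fibWord (1 + n)) r)
  (cong₂ _+_ (cong (isolatedCount l (fibWord (2 + n))) (headOr-fibWord-suc n r))
             (cong (λ c → isolatedCount c (fibWord (1 + n)) r) (lastOr-fibWord l (2 + n))))

agrees : Context → Bool → ℕ
agrees nothing _ = 0
agrees (just c) x = if c xor x then 0 else 1

agrees-comm : ∀ a b → agrees (just a) b ≡ agrees (just b) a
agrees-comm a b = cong (λ t → if t then 0 else 1) (xor-comm a b)

oddBonus : ℕ → ℕ
oddBonus n = if isOdd n then 2 else 0

-- the theorem's value of SM(f (4 + m))
singletonCount : ℕ → ℕ
singletonCount m = F (2 + m) + F m + oddBonus m

bonus≡agrees+agrees : ∀ b → (if b then 2 else 0) ≡ agrees (just true) b + agrees (just true) b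
bonus≡agrees+agrees true = refl
bonus≡agrees+agrees false = refl

singletonCount-rec : ∀ m → let e = agrees (just true) (isOdd (suc m)) in
  singletonCount (2 + m) + e + e ≡ singletonCount (1 + m) + singletonCount m
singletonCount-rec m = begin
  ((F (3 + m) + F (2 + m)) + (F (1 + m) + F m)) + oddBonus m + e + e
    ≡⟨ regroup (F (3 + m)) (F (2 + m)) (F (1 + m)) (F m) (oddBonus m) e ⟩
  (F (3 + m) + F (1 + m) + (e + e)) + (F (2 + m) + F m + oddBonus m)
    ≡⟨ cong (λ o → (F (3 + m) + F (1 + m) + o) + singletonCount m) (sym (bonus≡agrees+agrees (isOdd (suc m)))) ⟩
  singletonCount (1 + m) + singletonCount m ∎
  where
  open ≡-Reasoning
  e : ℕ
  e = agrees (just true) (isOdd (suc m))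
  regroup : ∀ a b c d o e → ((a + b) + (c + d)) + o + e + e ≡ (a + c + (e + e)) + (b + d + o)
  regroup = solve-∀

-- Each context letter that agrees with the adjacent end letter of f (4 + m) makes
-- that end letter non-isolated; all other letters are unaffected.
isolatedCount-fibWord : ∀ m l r → isolatedCount l (fibWord (4 + m)) r + agrees l true + agrees r (isOdd m) ≡ singletonCount m
isolatedCount-fibWord zero nothing nothing = refl
isolatedCount-fibWord zero nothing (just false) = refl
isolatedCount-fibWord zero nothing (just true) = refl
isolatedCount-fibWord zero (just false) nothing = refl
isolatedCount-fibWord zero (just false) (just false) = refl
isolatedCount-fibWord zero (just false) (just true) = refl
isolatedCount-fibWord zero (just true) nothing = refl
isolatedCount-fibWord zero (just true) (just false) = refl
isolatedCount-fibWord zero (just true) (just true) = refl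
isolatedCount-fibWord (suc zero) nothing nothing = refl
isolatedCount-fibWord (suc zero) nothing (just false) = refl
isolatedCount-fibWord (suc zero) nothing (just true) = refl
isolatedCount-fibWord (suc zero) (just false) nothing = refl
isolatedCount-fibWord (suc zero) (just false) (just false) = refl
isolatedCount-fibWord (suc zero) (just false) (just true) = refl
isolatedCount-fibWord (suc zero) (just true) nothing = refl
isolatedCount-fibWord (suc zero) (just true) (just false) = refl
isolatedCount-fibWord (suc zero) (just true) (just true) = refl
isolatedCount-fibWord (suc (suc m)) l r =
  trans (cong (λ c → c + agrees l true + agrees r (isOdd m)) (isolatedCount-fibWord-3+ l (3 + m) r))
        (glue (isolatedCount l (fibWord (5 + m)) (just true)) (isolatedCount (just o) (fibWord (4 + m)) r)
              (agrees l true) (agrees r (isOdd m)) (agrees (just true) o)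
              (isolatedCount-fibWord (suc m) l (just true))
              (subst (λ e → isolatedCount (just o) (fibWord (4 + m)) r + e + agrees r (isOdd m) ≡ singletonCount m)
                     (agrees-comm o true) (isolatedCount-fibWord m (just o) r))
              (singletonCount-rec m))
  where
  o : Bool
  o = isOdd (suc m)
  glue : ∀ a b x y e {s t u} → a + x + e ≡ s → b + e + y ≡ t → u + e + e ≡ s + t → (a + b) + x + y ≡ u
  glue a b x y e {s} {t} {u} a≡ b≡ u≡ = +-cancelʳ-≡ (e + e) _ _ (begin
    (a + b) + x + y + (e + e) ≡⟨ regroup a b x y e ⟩
    (a + x + e) + (b + e + y) ≡⟨ cong₂ _+_ a≡ b≡ ⟩
    s + t                     ≡⟨ sym u≡ ⟩
    u + e + e                 ≡⟨ +-assoc u e e ⟩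
    u + (e + e)               ∎)
    where
    open ≡-Reasoning
    regroup : ∀ a b x y e → (a + b) + x + y + (e + e) ≡ (a + x + e) + (b + e + y)
    regroup = solve-∀

oddBonus-%2 : ∀ m → ((m % 2 ≡ 1) → oddBonus m ≡ 2) × ((m % 2 ≡ 0) → oddBonus m ≡ 0)
oddBonus-%2 zero = (λ ()) , (λ _ → refl)
oddBonus-%2 (suc zero) = (λ _ → refl) , (λ ())
oddBonus-%2 (suc (suc m)) = oddBonus-%2 m

lemma6 : (n : ℕ) → 4 ≤ n →
    ((n % 2 ≡ 1) → HasCount (SingletonMCS (fibWord n)) (F (n ∸ 2) + F (n ∸ 4) + 2))
    × ((n % 2 ≡ 0) → HasCount (SingletonMCS (fibWord n)) (F (n ∸ 2) + F (n ∸ 4)))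
lemma6 (suc (suc (suc (suc m)))) (s≤s (s≤s (s≤s (s≤s z≤n)))) =
  (λ odd → hasCount (proj₁ (oddBonus-%2 m) odd)) ,
  (λ even → subst (HasCount (SingletonMCS (fibWord (4 + m)))) (+-identityʳ _) (hasCount (proj₂ (oddBonus-%2 m) even)))
  where
  hasCount : ∀ {b} → oddBonus m ≡ b → HasCount (SingletonMCS (fibWord (4 + m))) (F (2 + m) + F m + b)
  hasCount refl = subst (HasCount (SingletonMCS (fibWord (4 + m))))
    (trans (sym (trans (+-identityʳ _) (+-identityʳ _))) (isolatedCount-fibWord m nothing nothing))
    (singletonMCS-hasCount (fibWord (4 + m)))
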